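{- Let $s\ge1$, $\nu\geq 1$ and $a,b\in R$ with $a\equiv b$ mod $p^{\nu}$. Then $a\equiv b$ mod $p^{\nu+1}$ if and only if $\delta^{(s)}a\equiv \delta^{(s)} b$ mod $p^{\nu}$.
   Context: $p$ is an odd prime, $R$ is the $p$-adic completion of the ring of integers of the maximal unramified extension of $\mathbb Q_p$, and $\phi$ is the unique Frobenius lift on $R$ (ring endomorphism with $\phi(a)\equiv a^p$ mod $p$). For $s\ge 1$ and $a\in R$, $\delta^{(s)}a\in R$ is defined by $\phi^s(a)=a^{p^s}+p\,\delta^{(s)}a$. -}

module Defs where

open import Level using (Level; _⊔_) renaming (suc to lsuc)
open import Data.Nat as ℕ using (ℕ; zero; suc)
open import Data.List using (List; []; _∷_; length)
open import Data.Product using (∃; _×_)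
open import Relation.Nullary using (¬_)
open import Algebra.Bundles using (CommutativeRing; Semiring)
import Algebra.Definitions.RawSemiring as RawSemiringDefs
open import Algebra.Morphism.Structures using (IsRingHomomorphism)

iter : ∀ {a} {A : Set a} → (A → A) → ℕ → A → A
iter f zero    x = x
iter f (suc n) x = f (iter f n x)

module RingNotation {c ℓ} (R : CommutativeRing c ℓ) where
  open CommutativeRing R
  open RawSemiringDefs (Semiring.rawSemiring semiring) public using (_^_)
  private
    module M = RawSemiringDefs (Semiring.rawSemiring semiring)

  [_]ᴿ : ℕ → Carrier
  [ n ]ᴿ = n M.× 1#

  infix 4 _≡_[mod_]
  _≡_[mod_] : Carrier → Carrier → Carrier → Set (c ⊔ ℓ)
  x ≡ y [mod m ] = ∃ λ (z : Carrier) → (x - y) ≈ m * z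

  horner : List Carrier → Carrier → Carrier
  horner []       x = 0#
  horner (a ∷ as) x = a + x * horner as x

  evalMonic : List Carrier → Carrier → Carrier
  evalMonic as x = x ^ length as + horner as x

-- The hypotheses characterising (up to isomorphism) R = the p-adic completion of
-- the ring of integers of the maximal unramified extension of Q_p, i.e. W(F̄_p):
-- a p-torsion-free, p-adically separated and complete ring whose residue ring R/p
-- is an algebraically closed field algebraic over F_p (hence ≅ F̄_p).
record IsMaxUnramifiedCompletion (p : ℕ) {c ℓ} (R : CommutativeRing c ℓ) : Set (c ⊔ ℓ) where
  open CommutativeRing R
  open RingNotation R
  field
    p-torsionFree    : ∀ x → [ p ]ᴿ * x ≈ 0# → x ≈ 0#
    p-separated      : ∀ x → (∀ n → x ≡ 0# [mod [ p ]ᴿ ^ n ]) → x ≈ 0#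
    p-complete       : ∀ (f : ℕ → Carrier) → (∀ n → f (suc n) ≡ f n [mod [ p ]ᴿ ^ n ]) →
                       ∃ λ L → ∀ n → L ≡ f n [mod [ p ]ᴿ ^ n ]
    residueNontrivial : ¬ (1# ≡ 0# [mod [ p ]ᴿ ])
    residueField      : ∀ x → ¬ (x ≡ 0# [mod [ p ]ᴿ ]) → ∃ λ y → x * y ≡ 1# [mod [ p ]ᴿ ]
    residueAlgClosed  : ∀ (as : List Carrier) → 1 ℕ.≤ length as →
                        ∃ λ x → evalMonic as x ≡ 0# [mod [ p ]ᴿ ]
    residueAlgebraic  : ∀ x → ∃ λ n → (1 ℕ.≤ n) × (x ^ (p ℕ.^ n) ≡ x [mod [ p ]ᴿ ])

record IsFrobeniusLift (p : ℕ) {c ℓ} (R : CommutativeRing c ℓ)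
                       (φ : CommutativeRing.Carrier R → CommutativeRing.Carrier R) : Set (c ⊔ ℓ) where
  open CommutativeRing R
  open RingNotation R
  field
    isRingHom : IsRingHomomorphism rawRing rawRing φ
    frob      : ∀ a → φ a ≡ a ^ p [mod [ p ]ᴿ ]

{-# OPTIONS --safe #-}
-- Write a - b = pᵛ z and q = pˢ. As φˢ is a ring endomorphism fixing p,
-- φˢa - φˢb = pᵛ φˢz, so p (δa - δb) = pᵛ φˢz - (aᵠ - bᵠ). Here pᵛ⁺¹ divides aᵠ - bᵠ,
-- since it is (a - b) times a geometric sum congruent to q bᵠ⁻¹ ≡ 0 mod p. Cancelling the
-- non-zero-divisor p, the two sides of the equivalence become p ∣ z and p ∣ φˢz, and these
-- agree because φˢz ≡ z^q mod p while the residue ring has no nilpotents (every residue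
-- satisfies x^(pⁿ) = x for some n ≥ 1).
module Submission where

open import Level using (_⊔_)
open import Data.Nat as ℕ using (ℕ; zero; suc; _≤_)
import Data.Nat.Properties as ℕₚ
open import Data.Nat.Primality using (Prime; prime⇒nonZero)
open import Data.Product using (_,_)
import Relation.Binary.PropositionalEquality as Eq
open import Relation.Nullary using (¬_)
open import Function.Bundles using (_⇔_; mk⇔; Equivalence)
open import Function.Properties.Equivalence using (⇔-setoid)
open import Algebra.Bundles using (CommutativeRing)
open import Algebra.Morphism.Structures using (IsRingHomomorphism)
import Algebra.Morphism.Construct.Identity as Identity
import Algebra.Morphism.Construct.Composition as Composition
open import Defs

module CommutativeRingDivisibility {c ℓ} (R : CommutativeRing c ℓ) where
  open CommutativeRing R
  open RingNotation R
  open import Relation.Binary.Reasoning.Setoid setoid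
  open import Algebra.Properties.Semiring.Divisibility semiring public
    using (_∣_; _,_; _∣0; ∣ʳ-refl; ∣ʳ-trans; ∣ʳ-respˡ-≈; ∣ʳ-respʳ-≈; x∣ʳy⇒x∣ʳzy)
  open import Algebra.Properties.CommutativeSemigroup.Divisibility *-commutativeSemigroup public
    using (x∣y⇒zx∣zy; ∙-cong-∣; x∣xy)
  open import Algebra.Properties.Ring ring using (-‿distribˡ-*; x[y-z]≈xy-xz; [y-z]x≈yx-zx)
  open import Algebra.Properties.AbelianGroup +-abelianGroup
    using (⁻¹-anti-homo‿-; ⁻¹-∙-comm; xyx⁻¹≈y; //-rightDividesˡ; x∙y⁻¹≈ε⇒x≈y; x≈y⇒x∙y⁻¹≈ε)
  open import Algebra.Properties.Semiring.Exp semiring using (^-assocʳ)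
  open import Algebra.Properties.Semiring.Mult semiring using (×1-homo-*)
  open import Algebra.Properties.CommutativeSemigroup +-commutativeSemigroup
    using () renaming (interchange to +-interchange)
  open import Algebra.Properties.CommutativeSemigroup *-commutativeSemigroup using (x∙yz≈y∙xz)

  [x-y]+[y-z]≈x-z : ∀ x y z → (x - y) + (y - z) ≈ x - z
  [x-y]+[y-z]≈x-z x y z = begin
    (x - y) + (y - z)   ≈⟨ +-assoc x (- y) (y - z) ⟩
    x + (- y + (y - z)) ≈⟨ +-congˡ (+-assoc (- y) y (- z)) ⟨
    x + ((- y + y) - z) ≈⟨ +-congˡ (+-congʳ (-‿inverseˡ y)) ⟩
    x + (0# - z)        ≈⟨ +-congˡ (+-identityˡ (- z)) ⟩
    x - z               ∎

  [x+y]-[u+v]≈[x-u]+[y-v] : ∀ x y u v → (x + y) - (u + v) ≈ (x - u) + (y - v)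
  [x+y]-[u+v]≈[x-u]+[y-v] x y u v = begin
    (x + y) - (u + v)     ≈⟨ +-congˡ (⁻¹-∙-comm u v) ⟨
    (x + y) + (- u + - v) ≈⟨ +-interchange x y (- u) (- v) ⟩
    (x - u) + (y - v)     ∎

  ∣-cong-⇔ : ∀ {m m′ x x′} → m ≈ m′ → x ≈ x′ → (m ∣ x ⇔ m′ ∣ x′)
  ∣-cong-⇔ m≈m′ x≈x′ = mk⇔
    (λ m∣x → ∣ʳ-respˡ-≈ m≈m′ (∣ʳ-respʳ-≈ x≈x′ m∣x))
    (λ m′∣x′ → ∣ʳ-respˡ-≈ (sym m≈m′) (∣ʳ-respʳ-≈ (sym x≈x′) m′∣x′))

  ∣x∣y⇒∣x+y : ∀ {m x y} → m ∣ x → m ∣ y → m ∣ x + y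
  ∣x∣y⇒∣x+y (q , qm≈x) (r , rm≈y) = q + r , trans (distribʳ _ q r) (+-cong qm≈x rm≈y)

  ∣x⇒∣-x : ∀ {m x} → m ∣ x → m ∣ - x
  ∣x⇒∣-x {m} (q , qm≈x) = - q , trans (sym (-‿distribˡ-* q m)) (-‿cong qm≈x)

  ∣x⇒∣x+y⇔∣y : ∀ {m x y} → m ∣ x → (m ∣ x + y ⇔ m ∣ y)
  ∣x⇒∣x+y⇔∣y {x = x} {y} m∣x = mk⇔
    (λ m∣x+y → ∣ʳ-respʳ-≈ (xyx⁻¹≈y x y) (∣x∣y⇒∣x+y m∣x+y (∣x⇒∣-x m∣x)))
    (∣x∣y⇒∣x+y m∣x)

  ∣x⇒∣xⁿ : ∀ {m x n} → 1 ≤ n → m ∣ x → m ∣ x ^ n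
  ∣x⇒∣xⁿ {x = x} {suc n} _ m∣x = ∣ʳ-trans m∣x (x∣xy x (x ^ n))

  [m]ᴿ∣[mⁿ]ᴿ : ∀ {m n} → 1 ≤ n → [ m ]ᴿ ∣ [ m ℕ.^ n ]ᴿ
  [m]ᴿ∣[mⁿ]ᴿ {m} {suc n} _ = [ m ℕ.^ n ]ᴿ , trans (*-comm _ _) (sym (×1-homo-* m (m ℕ.^ n)))

  ≡[mod]⇔∣ : ∀ {m x y} → x ≡ y [mod m ] ⇔ m ∣ x - y
  ≡[mod]⇔∣ {m} = mk⇔ (λ (z , x-y≈mz) → z , trans (*-comm z m) (sym x-y≈mz))
                     (λ (q , qm≈x-y) → q , trans (sym qm≈x-y) (*-comm q m))

  private
    module ≡[mod]⇔∣ {m x y} = Equivalence (≡[mod]⇔∣ {m} {x} {y})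

  mod-reflexive : ∀ {m x y} → x ≈ y → x ≡ y [mod m ]
  mod-reflexive {m} x≈y = ≡[mod]⇔∣.from (∣ʳ-respʳ-≈ (sym (x≈y⇒x∙y⁻¹≈ε x≈y)) (m ∣0))

  mod-refl : ∀ {m x} → x ≡ x [mod m ]
  mod-refl = mod-reflexive refl

  mod-sym : ∀ {m x y} → x ≡ y [mod m ] → y ≡ x [mod m ]
  mod-sym {x = x} {y} x≡y = ≡[mod]⇔∣.from (∣ʳ-respʳ-≈ (⁻¹-anti-homo‿- x y) (∣x⇒∣-x (≡[mod]⇔∣.to x≡y)))

  mod-trans : ∀ {m x y z} → x ≡ y [mod m ] → y ≡ z [mod m ] → x ≡ z [mod m ]
  mod-trans {x = x} {y} {z} x≡y y≡z = ≡[mod]⇔∣.from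
    (∣ʳ-respʳ-≈ ([x-y]+[y-z]≈x-z x y z) (∣x∣y⇒∣x+y (≡[mod]⇔∣.to x≡y) (≡[mod]⇔∣.to y≡z)))

  mod-+-cong : ∀ {m x x′ y y′} → x ≡ x′ [mod m ] → y ≡ y′ [mod m ] → x + y ≡ x′ + y′ [mod m ]
  mod-+-cong {x = x} {x′} {y} {y′} x≡x′ y≡y′ = ≡[mod]⇔∣.from
    (∣ʳ-respʳ-≈ (sym ([x+y]-[u+v]≈[x-u]+[y-v] x y x′ y′))
                (∣x∣y⇒∣x+y (≡[mod]⇔∣.to x≡x′) (≡[mod]⇔∣.to y≡y′)))

  mod-*-cong : ∀ {m x x′ y y′} → x ≡ x′ [mod m ] → y ≡ y′ [mod m ] → x * y ≡ x′ * y′ [mod m ]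
  mod-*-cong {x = x} {x′} {y} {y′} x≡x′ y≡y′ = ≡[mod]⇔∣.from (∣ʳ-respʳ-≈ telescope
    (∣x∣y⇒∣x+y (x∣ʳy⇒x∣ʳzy x (≡[mod]⇔∣.to y≡y′)) (x∣ʳy⇒x∣ʳzy y′ (≡[mod]⇔∣.to x≡x′))))
    where
    telescope : x * (y - y′) + y′ * (x - x′) ≈ x * y - x′ * y′
    telescope = begin
      x * (y - y′) + y′ * (x - x′)              ≈⟨ +-cong (x[y-z]≈xy-xz x y y′) (x[y-z]≈xy-xz y′ x x′) ⟩
      (x * y - x * y′) + (y′ * x - y′ * x′)     ≈⟨ +-congˡ (+-cong (*-comm y′ x) (-‿cong (*-comm y′ x′))) ⟩
      (x * y - x * y′) + (x * y′ - x′ * y′)     ≈⟨ [x-y]+[y-z]≈x-z (x * y) (x * y′) (x′ * y′) ⟩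
      x * y - x′ * y′                           ∎

  mod-^-cong : ∀ {m x y} → x ≡ y [mod m ] → ∀ n → x ^ n ≡ y ^ n [mod m ]
  mod-^-cong x≡y zero    = mod-refl
  mod-^-cong x≡y (suc n) = mod-*-cong x≡y (mod-^-cong x≡y n)

  ∣x-y∣y⇒∣x : ∀ {m x y} → m ∣ x - y → m ∣ y → m ∣ x
  ∣x-y∣y⇒∣x {x = x} {y} m∣x-y m∣y = ∣ʳ-respʳ-≈ (//-rightDividesˡ y x) (∣x∣y⇒∣x+y m∣x-y m∣y)

  mod⇒∣⇔∣ : ∀ {m x y} → x ≡ y [mod m ] → (m ∣ x ⇔ m ∣ y)
  mod⇒∣⇔∣ x≡y = mk⇔ (∣x-y∣y⇒∣x (≡[mod]⇔∣.to (mod-sym x≡y))) (∣x-y∣y⇒∣x (≡[mod]⇔∣.to x≡y))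

  ^-iterate-mod : ∀ {m x k} → x ^ k ≡ x [mod m ] → ∀ j → x ^ (k ℕ.^ j) ≡ x [mod m ]
  ^-iterate-mod {x = x} xᵏ≡x zero    = mod-reflexive (*-identityʳ x)
  ^-iterate-mod {x = x} {k} xᵏ≡x (suc j) = mod-trans
    (mod-reflexive (sym (^-assocʳ x k (k ℕ.^ j))))
    (mod-trans (mod-^-cong xᵏ≡x (k ℕ.^ j)) (^-iterate-mod xᵏ≡x j))

  geometricSum : Carrier → Carrier → ℕ → Carrier
  geometricSum x y zero    = 0#
  geometricSum x y (suc n) = x ^ n + y * geometricSum x y n

  [x-y]*geometricSum≈xⁿ-yⁿ : ∀ x y n → (x - y) * geometricSum x y n ≈ x ^ n - y ^ n
  [x-y]*geometricSum≈xⁿ-yⁿ x y zero    = trans (zeroʳ (x - y)) (sym (-‿inverseʳ 1#))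
  [x-y]*geometricSum≈xⁿ-yⁿ x y (suc n) = begin
    (x - y) * (x ^ n + y * G)                       ≈⟨ distribˡ (x - y) (x ^ n) (y * G) ⟩
    (x - y) * x ^ n + (x - y) * (y * G)             ≈⟨ +-cong ([y-z]x≈yx-zx (x ^ n) x y) (x∙yz≈y∙xz (x - y) y G) ⟩
    (x * x ^ n - y * x ^ n) + y * ((x - y) * G)     ≈⟨ +-congˡ (*-congˡ ([x-y]*geometricSum≈xⁿ-yⁿ x y n)) ⟩
    (x * x ^ n - y * x ^ n) + y * (x ^ n - y ^ n)   ≈⟨ +-congˡ (x[y-z]≈xy-xz y (x ^ n) (y ^ n)) ⟩
    (x * x ^ n - y * x ^ n) + (y * x ^ n - y * y ^ n) ≈⟨ [x-y]+[y-z]≈x-z (x * x ^ n) (y * x ^ n) (y * y ^ n) ⟩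
    x * x ^ n - y * y ^ n                           ∎
    where G = geometricSum x y n

  geometricSum-mod : ∀ {m x y} → x ≡ y [mod m ] → ∀ n →
                     geometricSum x y (suc n) ≡ [ suc n ]ᴿ * y ^ n [mod m ]
  geometricSum-mod {y = y} x≡y zero = mod-reflexive (begin
    1# + y * 0#     ≈⟨ +-congˡ (zeroʳ y) ⟩
    1# + 0#         ≈⟨ *-identityʳ (1# + 0#) ⟨
    (1# + 0#) * 1#  ∎)
  geometricSum-mod {y = y} x≡y (suc n) = mod-trans
    (mod-+-cong (mod-^-cong x≡y (suc n)) (mod-*-cong mod-refl (geometricSum-mod x≡y n)))
    (mod-reflexive (begin
      y * y ^ n + y * (k * y ^ n)         ≈⟨ +-cong (*-identityˡ _) (x∙yz≈y∙xz k y (y ^ n)) ⟨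
      1# * (y * y ^ n) + k * (y * y ^ n)  ≈⟨ distribʳ (y * y ^ n) 1# k ⟨
      (1# + k) * (y * y ^ n)              ∎))
    where k = [ suc n ]ᴿ

  ∣x-y∣[n]⇒∣geometricSum : ∀ {π x y} n → π ∣ x - y → π ∣ [ n ]ᴿ → π ∣ geometricSum x y n
  ∣x-y∣[n]⇒∣geometricSum {π} zero    _     _    = π ∣0
  ∣x-y∣[n]⇒∣geometricSum {y = y} (suc n) π∣x-y π∣n = Equivalence.from
    (mod⇒∣⇔∣ (geometricSum-mod (≡[mod]⇔∣.from π∣x-y) n)) (∣ʳ-trans π∣n (x∣xy _ (y ^ n)))

  ∣x-y⇒∣xⁿ-yⁿ : ∀ {m π x y} n → m ∣ x - y → π ∣ m → π ∣ [ n ]ᴿ → m * π ∣ x ^ n - y ^ n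
  ∣x-y⇒∣xⁿ-yⁿ {x = x} {y} n m∣x-y π∣m π∣n = ∣ʳ-respʳ-≈ ([x-y]*geometricSum≈xⁿ-yⁿ x y n)
    (∙-cong-∣ m∣x-y (∣x-y∣[n]⇒∣geometricSum n (∣ʳ-trans π∣m m∣x-y) π∣n))

  NonZeroDivisor : Carrier → Set (c ⊔ ℓ)
  NonZeroDivisor π = ∀ x → π * x ≈ 0# → x ≈ 0#

  *-nonZeroDivisor : ∀ {π ρ} → NonZeroDivisor π → NonZeroDivisor ρ → NonZeroDivisor (π * ρ)
  *-nonZeroDivisor {π} {ρ} π-nzd ρ-nzd x πρx≈0 = ρ-nzd x (π-nzd (ρ * x) (trans (sym (*-assoc π ρ x)) πρx≈0))

  ^-nonZeroDivisor : ∀ {π} → NonZeroDivisor π → ∀ n → NonZeroDivisor (π ^ n)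
  ^-nonZeroDivisor π-nzd zero    x 1x≈0 = trans (sym (*-identityˡ x)) 1x≈0
  ^-nonZeroDivisor π-nzd (suc n) = *-nonZeroDivisor π-nzd (^-nonZeroDivisor π-nzd n)

  *-cancelˡ-∣ : ∀ {π m x} → NonZeroDivisor π → π * m ∣ π * x → m ∣ x
  *-cancelˡ-∣ {π} {m} {x} π-nzd (q , qπm≈πx) = q , x∙y⁻¹≈ε⇒x≈y (q * m) x (π-nzd (q * m - x) (begin
    π * (q * m - x)      ≈⟨ x[y-z]≈xy-xz π (q * m) x ⟩
    π * (q * m) - π * x  ≈⟨ +-congʳ (x∙yz≈y∙xz π q m) ⟩
    q * (π * m) - π * x  ≈⟨ x≈y⇒x∙y⁻¹≈ε qπm≈πx ⟩
    0#                   ∎))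

  *-cancelˡ-∣-⇔ : ∀ {π m x} → NonZeroDivisor π → (π * m ∣ π * x ⇔ m ∣ x)
  *-cancelˡ-∣-⇔ {π} π-nzd = mk⇔ (*-cancelˡ-∣ π-nzd) (x∣y⇒zx∣zy π)

module RingEndomorphism {c ℓ} (R : CommutativeRing c ℓ)
  {h : CommutativeRing.Carrier R → CommutativeRing.Carrier R}
  (isRingHom : IsRingHomomorphism (CommutativeRing.rawRing R) (CommutativeRing.rawRing R) h) where
  open CommutativeRing R
  open RingNotation R
  open IsRingHomomorphism isRingHom
  open import Relation.Binary.Reasoning.Setoid setoid
  open import Algebra.Properties.Semiring.Exp semiring using (^-congˡ)

  iter-isRingHomomorphism : ∀ s → IsRingHomomorphism rawRing rawRing (iter h s)
  iter-isRingHomomorphism zero    = Identity.isRingHomomorphism rawRing refl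
  iter-isRingHomomorphism (suc s) =
    Composition.isRingHomomorphism trans (iter-isRingHomomorphism s) isRingHom

  -homo : ∀ x y → h (x - y) ≈ h x - h y
  -homo x y = trans (+-homo x (- y)) (+-congˡ (-‿homo y))

  ^-homo : ∀ x n → h (x ^ n) ≈ h x ^ n
  ^-homo x zero    = 1#-homo
  ^-homo x (suc n) = trans (*-homo x (x ^ n)) (*-congˡ (^-homo x n))

  []ᴿ-homo : ∀ n → h [ n ]ᴿ ≈ [ n ]ᴿ
  []ᴿ-homo zero    = 0#-homo
  []ᴿ-homo (suc n) = trans (+-homo 1# [ n ]ᴿ) (+-cong 1#-homo ([]ᴿ-homo n))

  homo-difference : ∀ {x y z n k} → x - y ≈ [ n ]ᴿ ^ k * z → h x - h y ≈ [ n ]ᴿ ^ k * h z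
  homo-difference {x} {y} {z} {n} {k} x-y≈nᵏz = begin
    h x - h y            ≈⟨ -homo x y ⟨
    h (x - y)            ≈⟨ ⟦⟧-cong x-y≈nᵏz ⟩
    h ([ n ]ᴿ ^ k * z)   ≈⟨ *-homo ([ n ]ᴿ ^ k) z ⟩
    h ([ n ]ᴿ ^ k) * h z ≈⟨ *-congʳ (trans (^-homo [ n ]ᴿ k) (^-congˡ k ([]ᴿ-homo n))) ⟩
    [ n ]ᴿ ^ k * h z     ∎

module FrobeniusLift {c ℓ} (p : ℕ) (R : CommutativeRing c ℓ)
  {φ : CommutativeRing.Carrier R → CommutativeRing.Carrier R} (lift : IsFrobeniusLift p R φ) where
  open CommutativeRing R
  open RingNotation R
  open CommutativeRingDivisibility R
  open IsFrobeniusLift lift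
  open import Algebra.Properties.Semiring.Exp semiring using (^-assocʳ; ^-congʳ)

  iter-frob : ∀ s x → iter φ s x ≡ x ^ (p ℕ.^ s) [mod [ p ]ᴿ ]
  iter-frob zero    x = mod-reflexive (sym (*-identityʳ x))
  iter-frob (suc s) x = mod-trans (frob (iter φ s x)) (mod-trans (mod-^-cong (iter-frob s x) p)
    (mod-reflexive (trans (^-assocʳ x (p ℕ.^ s) p) (^-congʳ x (ℕₚ.*-comm (p ℕ.^ s) p)))))

module MaxUnramifiedCompletion {c ℓ} (p : ℕ) .{{_ : ℕ.NonZero p}} (R : CommutativeRing c ℓ)
  (unramified : IsMaxUnramifiedCompletion p R) where
  open CommutativeRing R
  open RingNotation R
  open CommutativeRingDivisibility R
  open IsMaxUnramifiedCompletion unramified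
  open import Algebra.Properties.Semiring.Exp semiring using (^-assocʳ; ^-congʳ)

  -- x ≡ x^((pⁿ)ˢ) mod p, and (pⁿ)ˢ is a multiple of pˢ.
  ∣x⇔∣x^pˢ : ∀ s x → [ p ]ᴿ ∣ x ⇔ [ p ]ᴿ ∣ x ^ (p ℕ.^ s)
  ∣x⇔∣x^pˢ s x with residueAlgebraic x
  ... | suc n , _ , x^pⁿ≡x = mk⇔ (∣x⇒∣xⁿ (ℕₚ.m^n>0 p s)) λ p∣x^q →
    Equivalence.to (mod⇒∣⇔∣ (^-iterate-mod x^pⁿ≡x s))
      (∣ʳ-respʳ-≈ x^q^e≈x^[pⁿ]ˢ (∣x⇒∣xⁿ (ℕₚ.m^n>0 p (n ℕ.* s)) p∣x^q))
    where
    q = p ℕ.^ s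
    e = p ℕ.^ (n ℕ.* s)
    x^q^e≈x^[pⁿ]ˢ : (x ^ q) ^ e ≈ x ^ ((p ℕ.^ suc n) ℕ.^ s)
    x^q^e≈x^[pⁿ]ˢ = trans (^-assocʳ x q e) (^-congʳ x (Eq.sym
      (Eq.trans (ℕₚ.^-*-assoc p (suc n) s) (ℕₚ.^-distribˡ-+-* p s (n ℕ.* s)))))

open import Data.Nat.Divisibility using (_∣_)

lemma2p19 : ∀ {c ℓ} (p : ℕ) → Prime p → ¬ (2 ∣ p) →
            (R : CommutativeRing c ℓ) → IsMaxUnramifiedCompletion p R →
            (φ : CommutativeRing.Carrier R → CommutativeRing.Carrier R) → IsFrobeniusLift p R φ →
            let open CommutativeRing R
                open RingNotation R
            in (s ν : ℕ) → 1 ≤ s → 1 ≤ ν →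
               (a b δa δb : Carrier) →
               iter φ s a ≈ a ^ (p ℕ.^ s) + [ p ]ᴿ * δa →
               iter φ s b ≈ b ^ (p ℕ.^ s) + [ p ]ᴿ * δb →
               a ≡ b [mod [ p ]ᴿ ^ ν ] →
               ((a ≡ b [mod [ p ]ᴿ ^ suc ν ]) ⇔ (δa ≡ δb [mod [ p ]ᴿ ^ ν ]))
lemma2p19 {c} {ℓ} p p-prime _ R unramified φ lift s ν 1≤s 1≤ν a b δa δb φˢa≈ φˢb≈
          a≡b@(z , a-b≈Pᵛz) =
  begin
    a ≡ b [mod P ^ suc ν ]                          ≈⟨ ≡[mod]⇔∣ ⟩
    P ^ suc ν ∣ᴿ a - b                              ≈⟨ ∣-cong-⇔ (*-comm P (P ^ ν)) a-b≈Pᵛz ⟩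
    P ^ ν * P ∣ᴿ P ^ ν * z                          ≈⟨ *-cancelˡ-∣-⇔ (^-nonZeroDivisor p-torsionFree ν) ⟩
    P ∣ᴿ z                                          ≈⟨ ∣x⇔∣x^pˢ s z ⟩
    P ∣ᴿ z ^ q                                      ≈⟨ mod⇒∣⇔∣ (iter-frob s z) ⟨
    P ∣ᴿ iter φ s z                                 ≈⟨ *-cancelˡ-∣-⇔ (^-nonZeroDivisor p-torsionFree ν) ⟨
    P ^ ν * P ∣ᴿ P ^ ν * iter φ s z                 ≈⟨ ∣-cong-⇔ refl (homo-difference {n = p} {k = ν} a-b≈Pᵛz) ⟨
    P ^ ν * P ∣ᴿ iter φ s a - iter φ s b            ≈⟨ ∣-cong-⇔ refl (+-cong φˢa≈ (-‿cong φˢb≈)) ⟩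
    P ^ ν * P ∣ᴿ (a ^ q + P * δa) - (b ^ q + P * δb) ≈⟨ ∣-cong-⇔ refl ([x+y]-[u+v]≈[x-u]+[y-v] _ _ _ _) ⟩
    P ^ ν * P ∣ᴿ (a ^ q - b ^ q) + (P * δa - P * δb) ≈⟨ ∣x⇒∣x+y⇔∣y Pᵛ⁺¹∣aᵠ-bᵠ ⟩
    P ^ ν * P ∣ᴿ P * δa - P * δb                    ≈⟨ ∣-cong-⇔ (*-comm P (P ^ ν)) (x[y-z]≈xy-xz P δa δb) ⟨
    P * P ^ ν ∣ᴿ P * (δa - δb)                      ≈⟨ *-cancelˡ-∣-⇔ p-torsionFree ⟩
    P ^ ν ∣ᴿ δa - δb                                 ≈⟨ ≡[mod]⇔∣ ⟨
    δa ≡ δb [mod P ^ ν ]                            ∎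
  where
  open CommutativeRing R
  open RingNotation R
  open CommutativeRingDivisibility R renaming (_∣_ to _∣ᴿ_)
  open IsMaxUnramifiedCompletion unramified
  open IsFrobeniusLift lift
  open RingEndomorphism R (RingEndomorphism.iter-isRingHomomorphism R isRingHom s)
  open FrobeniusLift p R lift
  open MaxUnramifiedCompletion p {{prime⇒nonZero p-prime}} R unramified
  open import Algebra.Properties.Ring ring using (x[y-z]≈xy-xz)
  open import Relation.Binary.Reasoning.Setoid (⇔-setoid (c ⊔ ℓ))
  P = [ p ]ᴿ
  q = p ℕ.^ s
  Pᵛ⁺¹∣aᵠ-bᵠ : P ^ ν * P ∣ᴿ a ^ q - b ^ q
  Pᵛ⁺¹∣aᵠ-bᵠ = ∣x-y⇒∣xⁿ-yⁿ q (Equivalence.to ≡[mod]⇔∣ a≡b) (∣x⇒∣xⁿ 1≤ν ∣ʳ-refl) ([m]ᴿ∣[mⁿ]ᴿ 1≤s)
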